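{- Let $n$, $a$, $q$, $r$ be integers with $n=qa+r$, $r\in\{0,a-1\}$, $a\ge 4$, $q\ge 2$ and $q<a-1$. Then for every $q$-bounded independent broadcast $f$ on $\overrightarrow{C}(n;1,a)$, $$\sigma(f) \le \begin{cases} \left\lfloor \frac{q-1}{q}\, n\right\rfloor - (q-2)|V_f^1| & \text{if } r=0,\\[1ex] \left\lfloor \frac{q-1}{q}\left(n-|V_f^1|\right)\right\rfloor - (q-2)|V_f^1| & \text{if } r=a-1,\end{cases}$$ where $V_f^1=\{v: f(v)=q\}$.
   Context: The oriented circulant graph $\overrightarrow{C}(n;1,a)$ has vertex set $\{v_0,\dots,v_{n-1}\}$ and arcs $v_iv_{i+1}$, $v_iv_{i+a}$, subscripts modulo $n$. $d(u,v)$ is the length of a shortest directed path from $u$ to $v$; $e(v)=\max_u d(v,u)$; $\mathrm{diam}$ is the maximum eccentricity. An independent broadcast is $f:V\to\{0,\dots,\mathrm{diam}\}$ with $f(v)\le e(v)$ for all $v$ and $d(u,v)>f(u)$ for all distinct $u,v$ with $f(u),f(v)>0$; its cost is $\sigma(f)=\sum_v f(v)$. It is $q$-bounded if $f(v)\le q$ for every $v$. -}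

module Defs where

open import Data.Nat using (ℕ; zero; suc; _+_; _*_; _∸_; _≤_; _<_; _≟_)
open import Data.Nat.DivMod using (_/_)
open import Data.Fin using (Fin; toℕ)
open import Data.Nat.ListAction using (sum)
open import Data.List using (List; map; filter; length; allFin)
open import Data.Product using (∃; _×_; _,_)
open import Data.Sum using (_⊎_)
open import Relation.Nullary using (¬_)
open import Relation.Binary.PropositionalEquality using (_≡_; _≢_)

-- Oriented circulant graph C(n;1,a) on vertices Fin n (v_i ↦ i).
-- i ≡ j + s (mod n), stated without division: toℕ i + s = toℕ j + k*n for some k.
StepBy : (n s : ℕ) → Fin n → Fin n → Set
StepBy n s i j = ∃ λ k → toℕ i + s ≡ toℕ j + k * n

Arc : (n a : ℕ) → Fin n → Fin n → Set
Arc n a i j = StepBy n 1 i j ⊎ StepBy n a i j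

data Walk (n a : ℕ) : ℕ → Fin n → Fin n → Set where
  here  : ∀ {u} → Walk n a zero u u
  there : ∀ {m u w v} → Arc n a u w → Walk n a m w v → Walk n a (suc m) u v

DistLE : (n a : ℕ) → Fin n → Fin n → ℕ → Set
DistLE n a u v k = ∃ λ m → m ≤ k × Walk n a m u v

DistLT : (n a : ℕ) → Fin n → Fin n → ℕ → Set
DistLT n a u v k = ∃ λ m → m < k × Walk n a m u v

-- f(v) ≤ e(v) = max_u d(v,u)  ⇔  some u has d(v,u) ≥ f(v)
WithinEcc : (n a : ℕ) → (Fin n → ℕ) → Fin n → Set
WithinEcc n a f v = ∃ λ u → ¬ DistLT n a v u (f v)

-- f(v) ≤ diam  ⇔  some x,y have d(x,y) ≥ f(v)
WithinDiam : (n a : ℕ) → (Fin n → ℕ) → Fin n → Set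
WithinDiam n a f v = ∃ λ x → ∃ λ y → ¬ DistLT n a x y (f v)

record IndependentBroadcast (n a : ℕ) (f : Fin n → ℕ) : Set where
  field
    withinDiam : ∀ v → WithinDiam n a f v
    withinEcc  : ∀ v → WithinEcc n a f v
    independent : ∀ u v → u ≢ v → 0 < f u → 0 < f v → ¬ DistLE n a u v (f u)

QBounded : (n q : ℕ) → (Fin n → ℕ) → Set
QBounded n q f = ∀ v → f v ≤ q

cost : (n : ℕ) → (Fin n → ℕ) → ℕ
cost n f = sum (map f (allFin n))

countEq : (n q : ℕ) → (Fin n → ℕ) → ℕ
countEq n q f = length (filter (λ v → f v ≟ q) (allFin n))

-- ⌊m / d⌋ (d = 0 never occurs in the statement since q ≥ 2; value 0 there is a dummy)
floorDiv : ℕ → ℕ → ℕ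
floorDiv m zero = zero
floorDiv m (suc d) = m / suc d

-- Give every vertex v with f(v) > 0 the private vertices v, v+1, …, v+f(v) and, when f(v) = q,
-- also the e vertices v + k·a + (q − k), 1 ≤ k ≤ e, where e = q − 1 if r = 0 and e = q if r = a − 1.
-- Each of them ends a walk from v of length at most f(v). Since (e+1)·a ≡ s (mod n) with s = 0
-- resp. s = 1, a private vertex shared by distinct u and v yields, after going once more around the
-- cycle along long chords if necessary, a walk of length at most f(u) from u to v (or vice versa),
-- contradicting independence. So the private sets are disjoint and their sizes add up to at most n.
-- A vertex of value t < q has t + 1 private vertices and q·t ≤ (q − 1)(t + 1); one of value q has
-- q + 1 + e of them and (q − 1)(q + 1 + e) = q·q + q(q − 2) + s(q − 1). Summing and dividing by q
-- gives both bounds.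
module Submission where

open import Defs
open import Data.Nat using (ℕ; zero; suc; _+_; _*_; _∸_; _≤_; _<_; _≟_; _≤?_; z≤n; s≤s; NonZero; pred; >-nonZero)
open import Data.Nat.Properties
open import Data.Nat.DivMod
open import Data.Nat.Divisibility using (_∣_; divides; >⇒∤)
open import Data.Nat.ListAction using (sum)
open import Data.Nat.Tactic.RingSolver using (solve; solve-∀)
open import Data.Fin using (Fin; toℕ)
import Data.Fin as Fin
open import Data.Fin.Properties using (toℕ-fromℕ<; toℕ-injective; toℕ<n; injective⇒≤)
open import Data.List using (List; []; _∷_; _++_; length; map; filter; allFin; applyUpTo; concatMap; lookup)
open import Data.List.Properties using (length-++; length-applyUpTo)
open import Data.List.Membership.Propositional using (_∈_)
open import Data.List.Membership.Propositional.Properties using (∈-lookup; ∈-++⁻; ∈-applyUpTo⁻)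
import Data.List.Relation.Unary.All as All
import Data.List.Relation.Unary.All.Properties as All
open import Data.List.Relation.Unary.AllPairs using ([]; _∷_)
import Data.List.Relation.Unary.AllPairs as AllPairs
import Data.List.Relation.Unary.AllPairs.Properties as AllPairs
open import Data.List.Relation.Unary.Unique.Propositional using (Unique)
open import Data.List.Relation.Unary.Unique.Propositional.Properties using (++⁺; concat⁺; applyUpTo⁺₁; allFin⁺)
open import Data.List.Relation.Binary.Disjoint.Propositional using (Disjoint)
open import Data.Product using (∃; ∃₂; _×_; _,_; proj₂)
open import Data.Sum using (_⊎_; inj₁; inj₂)
open import Function using (_∘_)
open import Level using (Level)
open import Relation.Nullary using (¬_; yes; no; contradiction)
open import Relation.Unary using (Pred; Decidable)
open import Relation.Binary.PropositionalEquality

private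
  variable
    ℓ : Level
    A B : Set ℓ

lookup-injective : {xs : List A} → Unique xs → ∀ i j → lookup xs i ≡ lookup xs j → i ≡ j
lookup-injective (_ ∷ _) Fin.zero Fin.zero _ = refl
lookup-injective (x∉xs ∷ _) Fin.zero (Fin.suc j) eq = contradiction eq (All.lookup x∉xs (∈-lookup j))
lookup-injective (x∉xs ∷ _) (Fin.suc i) Fin.zero eq = contradiction (sym eq) (All.lookup x∉xs (∈-lookup i))
lookup-injective (_ ∷ xs!) (Fin.suc i) (Fin.suc j) eq = cong Fin.suc (lookup-injective xs! i j eq)

Unique⇒length≤ : ∀ {n} {xs : List (Fin n)} → Unique xs → length xs ≤ n
Unique⇒length≤ xs! = injective⇒≤ (lookup-injective xs! _ _)

length-concatMap : (F : A → List B) (xs : List A) → length (concatMap F xs) ≡ sum (map (length ∘ F) xs)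
length-concatMap F [] = refl
length-concatMap F (x ∷ xs) = trans (length-++ (F x)) (cong (length (F x) +_) (length-concatMap F xs))

distrib-interchange : ∀ p x y c l → p * (x + y) + (c + l) ≡ (p * x + c) + (p * y + l)
distrib-interchange = solve-∀

module _ {P : Pred A ℓ} (P? : Decidable P) (g h : A → ℕ) {p c d : ℕ} where

  sum-weighted-≤ : (∀ x → P x → p * g x + c ≤ d * h x) → (∀ x → ¬ P x → p * g x ≤ d * h x) →
                   ∀ xs → p * sum (map g xs) + c * length (filter P? xs) ≤ d * sum (map h xs)
  sum-weighted-≤ _ _ [] = ≤-reflexive (trans (cong₂ _+_ (*-zeroʳ p) (*-zeroʳ c)) (sym (*-zeroʳ d)))
  sum-weighted-≤ yes-bound no-bound (x ∷ xs) with P? x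
  ... | yes px = begin
    p * (g x + G) + c * suc L       ≡⟨ cong (p * (g x + G) +_) (*-suc c L) ⟩
    p * (g x + G) + (c + c * L)     ≡⟨ distrib-interchange p (g x) G c (c * L) ⟩
    (p * g x + c) + (p * G + c * L) ≤⟨ +-mono-≤ (yes-bound x px) (sum-weighted-≤ yes-bound no-bound xs) ⟩
    d * h x + d * H                 ≡⟨ *-distribˡ-+ d (h x) H ⟨
    d * (h x + H)                   ∎
    where
    open ≤-Reasoning
    G = sum (map g xs)
    H = sum (map h xs)
    L = length (filter P? xs)
  ... | no ¬px = begin
    p * (g x + G) + c * L       ≡⟨ cong (_+ c * L) (*-distribˡ-+ p (g x) G) ⟩
    p * g x + p * G + c * L     ≡⟨ +-assoc (p * g x) (p * G) (c * L) ⟩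
    p * g x + (p * G + c * L)   ≤⟨ +-mono-≤ (no-bound x ¬px) (sum-weighted-≤ yes-bound no-bound xs) ⟩
    d * h x + d * H             ≡⟨ *-distribˡ-+ d (h x) H ⟨
    d * (h x + H)               ∎
    where
    open ≤-Reasoning
    G = sum (map g xs)
    H = sum (map h xs)
    L = length (filter P? xs)

[m%n+o]%n≡[m+o]%n : ∀ m o n .{{_ : NonZero n}} → (m % n + o) % n ≡ (m + o) % n
[m%n+o]%n≡[m+o]%n m o n = begin
  (m % n + o) % n               ≡⟨ [m+kn]%n≡m%n (m % n + o) (m / n) n ⟨
  (m % n + o + m / n * n) % n   ≡⟨ cong (_% n) (+-assoc (m % n) o _) ⟩
  (m % n + (o + m / n * n)) % n ≡⟨ cong (λ k → (m % n + k) % n) (+-comm o _) ⟩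
  (m % n + (m / n * n + o)) % n ≡⟨ cong (_% n) (+-assoc (m % n) _ o) ⟨
  (m % n + m / n * n + o) % n   ≡⟨ cong (λ k → (k + o) % n) (m≡m%n+[m/n]*n m n) ⟨
  (m + o) % n                   ∎
  where open ≡-Reasoning

m*n≤o⇒n≤o/m : ∀ m {n o} .{{_ : NonZero m}} → m * n ≤ o → n ≤ o / m
m*n≤o⇒n≤o/m m {n} {o} m*n≤o = begin
  n         ≡⟨ m*n/n≡m n m ⟨
  n * m / m ≤⟨ /-monoˡ-≤ m (subst (_≤ o) (*-comm m n) m*n≤o) ⟩
  o / m     ∎
  where open ≤-Reasoning

pathSize : ℕ → ℕ
pathSize zero = zero
pathSize (suc t) = suc (suc t)

<pathSize⇒ : ∀ {j t} → j < pathSize t → 0 < t × j ≤ t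
<pathSize⇒ {t = suc t} (s≤s j≤1+t) = s≤s z≤n , j≤1+t

*-pathSize-≤ : ∀ {q t} → t < q → q * t ≤ (q ∸ 1) * pathSize t
*-pathSize-≤ {q} {zero} _ = ≤-reflexive (trans (*-zeroʳ q) (sym (*-zeroʳ (q ∸ 1))))
*-pathSize-≤ {suc q} {suc t} (s≤s t<q) = begin
  suc q * suc t         ≡⟨⟩
  suc t + q * suc t     ≤⟨ +-monoˡ-≤ (q * suc t) t<q ⟩
  q + q * suc t         ≡⟨ *-suc q (suc t) ⟨
  q * suc (suc t)       ∎
  where open ≤-Reasoning

module Cyclic (n : ℕ) .{{_ : NonZero n}} where

  infixl 6 _⊕_

  _⊕_ : Fin n → ℕ → Fin n
  u ⊕ x = (toℕ u + x) mod n

  toℕ-⊕ : ∀ u x → toℕ (u ⊕ x) ≡ (toℕ u + x) % n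
  toℕ-⊕ u x = toℕ-fromℕ< (m%n<n (toℕ u + x) n)

  ⊕-*n : ∀ u k → u ⊕ k * n ≡ u
  ⊕-*n u k = toℕ-injective (begin
    toℕ (u ⊕ k * n)     ≡⟨ toℕ-⊕ u (k * n) ⟩
    (toℕ u + k * n) % n ≡⟨ [m+kn]%n≡m%n (toℕ u) k n ⟩
    toℕ u % n           ≡⟨ m<n⇒m%n≡m (toℕ<n u) ⟩
    toℕ u               ∎)
    where open ≡-Reasoning

  ⊕-identityʳ : ∀ u → u ⊕ 0 ≡ u
  ⊕-identityʳ u = ⊕-*n u 0

  ⊕-assoc : ∀ u x y → u ⊕ x ⊕ y ≡ u ⊕ (x + y)
  ⊕-assoc u x y = toℕ-injective (begin
    toℕ (u ⊕ x ⊕ y)           ≡⟨ toℕ-⊕ (u ⊕ x) y ⟩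
    (toℕ (u ⊕ x) + y) % n     ≡⟨ cong (λ k → (k + y) % n) (toℕ-⊕ u x) ⟩
    ((toℕ u + x) % n + y) % n ≡⟨ [m%n+o]%n≡[m+o]%n (toℕ u + x) y n ⟩
    (toℕ u + x + y) % n       ≡⟨ cong (_% n) (+-assoc (toℕ u) x y) ⟩
    (toℕ u + (x + y)) % n     ≡⟨ toℕ-⊕ u (x + y) ⟨
    toℕ (u ⊕ (x + y))         ∎)
    where open ≡-Reasoning

  ⊕-cancelʳ : ∀ {u v} x → u ⊕ x ≡ v ⊕ x → u ≡ v
  ⊕-cancelʳ {u} {v} x eq = begin
    u                   ≡⟨ ⊕-*n u x ⟨
    u ⊕ x * n           ≡⟨ cong (u ⊕_) x*n≡x+x*pred-n ⟩
    u ⊕ (x + x * pred n) ≡⟨ ⊕-assoc u x _ ⟨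
    u ⊕ x ⊕ x * pred n  ≡⟨ cong (_⊕ x * pred n) eq ⟩
    v ⊕ x ⊕ x * pred n  ≡⟨ ⊕-assoc v x _ ⟩
    v ⊕ (x + x * pred n) ≡⟨ cong (v ⊕_) x*n≡x+x*pred-n ⟨
    v ⊕ x * n           ≡⟨ ⊕-*n v x ⟩
    v                   ∎
    where
    open ≡-Reasoning
    x*n≡x+x*pred-n : x * n ≡ x + x * pred n
    x*n≡x+x*pred-n = trans (cong (x *_) (sym (suc-pred n))) (*-suc x (pred n))

  ⊕-cancel-+ʳ : ∀ {u v} x y z → u ⊕ (x + z) ≡ v ⊕ (y + z) → u ⊕ x ≡ v ⊕ y
  ⊕-cancel-+ʳ {u} {v} x y z eq =
    ⊕-cancelʳ z (trans (⊕-assoc u x z) (trans eq (sym (⊕-assoc v y z))))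

  ⊕-fixed⇒∣ : ∀ u d → u ⊕ d ≡ u → n ∣ d
  ⊕-fixed⇒∣ u d eq = divides ((toℕ u + d) / n) (+-cancelˡ-≡ (toℕ u) _ _ (begin
    toℕ u + d                                   ≡⟨ m≡m%n+[m/n]*n (toℕ u + d) n ⟩
    (toℕ u + d) % n + (toℕ u + d) / n * n       ≡⟨ cong (_+ (toℕ u + d) / n * n) (trans (sym (toℕ-⊕ u d)) (cong toℕ eq)) ⟩
    toℕ u + (toℕ u + d) / n * n                 ∎))
    where open ≡-Reasoning

  ⊕-injective-< : ∀ u {x y} → x < y → y < n → u ⊕ x ≢ u ⊕ y
  ⊕-injective-< u {x} {y} x<y y<n eq with d , 1+x+d≡y ← m≤n⇒∃[o]m+o≡n x<y =
    >⇒∤ {{_}} (≤-<-trans (m≤n+m (suc d) x) (subst (_< n) (sym x+1+d≡y) y<n)) (⊕-fixed⇒∣ (u ⊕ x) (suc d) (begin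
      u ⊕ x ⊕ suc d   ≡⟨ ⊕-assoc u x (suc d) ⟩
      u ⊕ (x + suc d) ≡⟨ cong (u ⊕_) x+1+d≡y ⟩
      u ⊕ y           ≡⟨ eq ⟨
      u ⊕ x           ∎))
    where
    open ≡-Reasoning
    x+1+d≡y : x + suc d ≡ y
    x+1+d≡y = trans (+-suc x d) 1+x+d≡y

  stepBy-⊕ : ∀ u s → StepBy n s u (u ⊕ s)
  stepBy-⊕ u s = (toℕ u + s) / n , (begin
    toℕ u + s                             ≡⟨ m≡m%n+[m/n]*n (toℕ u + s) n ⟩
    (toℕ u + s) % n + (toℕ u + s) / n * n ≡⟨ cong (_+ (toℕ u + s) / n * n) (toℕ-⊕ u s) ⟨
    toℕ (u ⊕ s) + (toℕ u + s) / n * n     ∎)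
    where open ≡-Reasoning

  walk : ∀ a k x u → Walk n a (k + x) u (u ⊕ (k * a + x))
  walk a zero zero u = subst (Walk n a 0 u) (sym (⊕-identityʳ u)) here
  walk a zero (suc x) u =
    there (inj₁ (stepBy-⊕ u 1)) (subst (Walk n a x (u ⊕ 1)) (⊕-assoc u 1 x) (walk a zero x (u ⊕ 1)))
  walk a (suc k) x u =
    there (inj₂ (stepBy-⊕ u a)) (subst (Walk n a (k + x) (u ⊕ a)) ⊕-long (walk a k x (u ⊕ a)))
    where
    ⊕-long : u ⊕ a ⊕ (k * a + x) ≡ u ⊕ (suc k * a + x)
    ⊕-long = trans (⊕-assoc u a (k * a + x)) (cong (u ⊕_) (sym (+-assoc a (k * a) x)))

-- Here a = a' + 1, and e + 1 long chords overshoot a full turn of the cycle by s ∈ {0, 1}.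
module Footprints
  (n a' q e s : ℕ) .{{_ : NonZero n}}
  (e+1≡q+s : suc e ≡ q + s) (s≤1 : s ≤ 1) ([e+1]a≡n+s : suc e * suc a' ≡ n + s)
  (0<q : 0 < q) (0<a' : 0 < a')
  (f : Fin n → ℕ) (ib : IndependentBroadcast n (suc a') f) (qb : QBounded n q f)
  where

  open Cyclic n
  open IndependentBroadcast ib using (independent)

  a : ℕ
  a = suc a'

  instance
    a'-nonZero : NonZero a'
    a'-nonZero = >-nonZero 0<a'

  e≤q : e ≤ q
  e≤q = ≤-pred (≤-trans (≤-reflexive e+1≡q+s) (≤-trans (+-monoʳ-≤ q s≤1) (≤-reflexive (+-comm q 1))))

  n≡q+e*a'+a' : n ≡ q + e * a' + a'
  n≡q+e*a'+a' = +-cancelʳ-≡ s n _ (begin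
    n + s                 ≡⟨ [e+1]a≡n+s ⟨
    suc e * suc a'        ≡⟨ *-suc (suc e) a' ⟩
    suc e + suc e * a'    ≡⟨ cong (_+ suc e * a') e+1≡q+s ⟩
    q + s + (a' + e * a') ≡⟨ solve (q ∷ s ∷ a' ∷ e ∷ []) ⟩
    q + e * a' + a' + s   ∎)
    where open ≡-Reasoning

  q+e*a'<n : q + e * a' < n
  q+e*a'<n = subst (q + e * a' <_) (sym n≡q+e*a'+a') (m<m+n (q + e * a') 0<a')

  q<n : q < n
  q<n = ≤-<-trans (m≤m+n q (e * a')) q+e*a'<n

  extraOffset-< : ∀ {i} → i < e → q + suc i * a' < n
  extraOffset-< i<e = ≤-<-trans (+-monoʳ-≤ q (*-monoˡ-≤ a' i<e)) q+e*a'<n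

  fv≡q⇒0<fv : ∀ {v} → f v ≡ q → 0 < f v
  fv≡q⇒0<fv fv≡q = subst (0 <_) (sym fv≡q) 0<q

  unreachable : ∀ {u v} → u ≢ v → 0 < f u → 0 < f v → ∀ k x → k + x ≤ f u → u ⊕ (k * a + x) ≢ v
  unreachable u≢v 0<fu 0<fv k x k+x≤fu refl =
    independent _ _ u≢v 0<fu 0<fv (k + x , k+x≤fu , walk a k x _)

  ⊕-wrap : ∀ w → w ⊕ suc e * a ≡ w ⊕ s
  ⊕-wrap w = begin
    w ⊕ suc e * a ≡⟨ cong (w ⊕_) [e+1]a≡n+s ⟩
    w ⊕ (n + s)   ≡⟨ ⊕-assoc w n s ⟨
    w ⊕ n ⊕ s     ≡⟨ cong (λ t → w ⊕ t ⊕ s) (*-identityˡ n) ⟨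
    w ⊕ 1 * n ⊕ s ≡⟨ cong (_⊕ s) (⊕-*n w 1) ⟩
    w ⊕ s         ∎
    where open ≡-Reasoning

  wrap-around : ∀ {u v} m k l → k + l ≡ suc e → u ⊕ (s + m) ≡ v ⊕ k * a → v ≡ u ⊕ (l * a + m)
  wrap-around {u} {v} m k l k+l≡e+1 eq = ⊕-cancelʳ s (begin
    v ⊕ s               ≡⟨ ⊕-wrap v ⟨
    v ⊕ suc e * a       ≡⟨ cong (λ t → v ⊕ t * a) k+l≡e+1 ⟨
    v ⊕ (k + l) * a     ≡⟨ cong (v ⊕_) (*-distribʳ-+ a k l) ⟩
    v ⊕ (k * a + l * a) ≡⟨ ⊕-assoc v (k * a) (l * a) ⟨
    v ⊕ k * a ⊕ l * a   ≡⟨ cong (_⊕ l * a) eq ⟨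
    u ⊕ (s + m) ⊕ l * a ≡⟨ ⊕-assoc u (s + m) (l * a) ⟩
    u ⊕ (s + m + l * a) ≡⟨ cong (u ⊕_) (solve (s ∷ m ∷ l ∷ a' ∷ [])) ⟩
    u ⊕ (l * a + m + s) ≡⟨ ⊕-assoc u (l * a + m) s ⟨
    u ⊕ (l * a + m) ⊕ s ∎)
    where open ≡-Reasoning

  path-path-disjoint-≤ : ∀ {u v j j'} → u ≢ v → 0 < f u → 0 < f v → j ≤ f u → j' ≤ j → u ⊕ j ≢ v ⊕ j'
  path-path-disjoint-≤ {u} {v} {j} {j'} u≢v 0<fu 0<fv j≤fu j'≤j eq
    with d , j'+d≡j ← m≤n⇒∃[o]m+o≡n j'≤j =
    unreachable u≢v 0<fu 0<fv 0 d (≤-trans (m≤n+m d j') (≤-trans (≤-reflexive j'+d≡j) j≤fu)) (begin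
      u ⊕ d ≡⟨ ⊕-cancel-+ʳ d 0 j' (trans (cong (u ⊕_) (trans (+-comm d j') j'+d≡j)) eq) ⟩
      v ⊕ 0 ≡⟨ ⊕-identityʳ v ⟩
      v     ∎)
    where open ≡-Reasoning

  path-path-disjoint : ∀ {u v j j'} → u ≢ v → 0 < f u → 0 < f v → j ≤ f u → j' ≤ f v → u ⊕ j ≢ v ⊕ j'
  path-path-disjoint {j = j} {j'} u≢v 0<fu 0<fv j≤fu j'≤fv with ≤-total j' j
  ... | inj₁ j'≤j = path-path-disjoint-≤ u≢v 0<fu 0<fv j≤fu j'≤j
  ... | inj₂ j≤j' = path-path-disjoint-≤ (u≢v ∘ sym) 0<fv 0<fu j'≤fv j≤j' ∘ sym

  path-extra-disjoint : ∀ {u v j k x} → u ≢ v → 0 < f u → f v ≡ q → j ≤ f u → x + k ≡ q → k ≤ e →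
                        u ⊕ j ≢ v ⊕ (k * a + x)
  path-extra-disjoint {u} {v} {j} {k} {x} u≢v 0<fu fv≡q j≤fu x+k≡q k≤e eq with j ≤? x
  ... | yes j≤x with d , j+d≡x ← m≤n⇒∃[o]m+o≡n j≤x =
    unreachable (u≢v ∘ sym) (fv≡q⇒0<fv fv≡q) 0<fu k d k+d≤fv (⊕-cancelʳ j (begin
      v ⊕ (k * a + d) ⊕ j   ≡⟨ ⊕-assoc v (k * a + d) j ⟩
      v ⊕ (k * a + d + j)   ≡⟨ cong (v ⊕_) (solve (k ∷ a' ∷ d ∷ j ∷ [])) ⟩
      v ⊕ (k * a + (j + d)) ≡⟨ cong (λ t → v ⊕ (k * a + t)) j+d≡x ⟩
      v ⊕ (k * a + x)       ≡⟨ eq ⟨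
      u ⊕ j                 ∎))
    where
    open ≡-Reasoning
    k+d≤fv : k + d ≤ f v
    k+d≤fv = ≤-trans (m≤n+m (k + d) j) (≤-reflexive (begin
      j + (k + d) ≡⟨ solve (j ∷ k ∷ d ∷ []) ⟩
      j + d + k   ≡⟨ cong (_+ k) j+d≡x ⟩
      x + k       ≡⟨ x+k≡q ⟩
      q           ≡⟨ fv≡q ⟨
      f v         ∎))
  ... | no j≰x with m , x+s+m≡j ← m≤n⇒∃[o]m+o≡n (≤-trans (+-monoʳ-≤ x s≤1) (subst (_≤ j) (+-comm 1 x) (≰⇒> j≰x)))
                 | l , k+l≡e+1 ← m≤n⇒∃[o]m+o≡n (m≤n⇒m≤1+n k≤e) =
    unreachable u≢v 0<fu (fv≡q⇒0<fv fv≡q) l m l+m≤fu (sym (wrap-around {u} {v} m k l k+l≡e+1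
      (⊕-cancel-+ʳ {u} {v} (s + m) (k * a) x (begin
        u ⊕ (s + m + x) ≡⟨ cong (u ⊕_) (solve (s ∷ m ∷ x ∷ [])) ⟩
        u ⊕ (x + s + m) ≡⟨ cong (u ⊕_) x+s+m≡j ⟩
        u ⊕ j           ≡⟨ eq ⟩
        v ⊕ (k * a + x) ∎))))
    where
    open ≡-Reasoning
    l≡x+s : l ≡ x + s
    l≡x+s = +-cancelˡ-≡ k l (x + s) (begin
      k + l       ≡⟨ k+l≡e+1 ⟩
      suc e       ≡⟨ e+1≡q+s ⟩
      q + s       ≡⟨ cong (_+ s) x+k≡q ⟨
      x + k + s   ≡⟨ solve (x ∷ k ∷ s ∷ []) ⟩
      k + (x + s) ∎)
    l+m≤fu : l + m ≤ f u
    l+m≤fu = ≤-trans (≤-reflexive (trans (cong (_+ m) l≡x+s) x+s+m≡j)) j≤fu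

  long-short-disjoint : ∀ {u v} d → u ≢ v → f u ≡ q → f v ≡ q → d ≤ e → u ⊕ d * a ≢ v ⊕ d
  long-short-disjoint zero u≢v _ _ _ eq = u≢v (⊕-cancelʳ 0 eq)
  long-short-disjoint {u} {v} (suc d) u≢v fu≡q fv≡q d<e eq
    with m , s+m≡1+d ← m≤n⇒∃[o]m+o≡n (≤-trans s≤1 (s≤s z≤n))
       | l , 1+d+l≡e+1 ← m≤n⇒∃[o]m+o≡n (m≤n⇒m≤1+n d<e) =
    unreachable (u≢v ∘ sym) (fv≡q⇒0<fv fv≡q) (fv≡q⇒0<fv fu≡q) l m (≤-reflexive (trans l+m≡q (sym fv≡q)))
      (sym (wrap-around {v} {u} m (suc d) l 1+d+l≡e+1 (trans (cong (v ⊕_) s+m≡1+d) (sym eq))))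
    where
    open ≡-Reasoning
    l+m≡q : l + m ≡ q
    l+m≡q = +-cancelˡ-≡ s (l + m) q (begin
      s + (l + m) ≡⟨ solve (s ∷ l ∷ m ∷ []) ⟩
      s + m + l   ≡⟨ cong (_+ l) s+m≡1+d ⟩
      suc d + l   ≡⟨ 1+d+l≡e+1 ⟩
      suc e       ≡⟨ e+1≡q+s ⟩
      q + s       ≡⟨ +-comm q s ⟩
      s + q       ∎)

  extra-extra-disjoint-≤ : ∀ {u v k k' x x'} → u ≢ v → f u ≡ q → f v ≡ q → x + k ≡ q → x' + k' ≡ q →
                           k ≤ e → k' ≤ k → u ⊕ (k * a + x) ≢ v ⊕ (k' * a + x')
  extra-extra-disjoint-≤ {u} {v} {k} {k'} {x} {x'} u≢v fu≡q fv≡q x+k≡q x'+k'≡q k≤e k'≤k eq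
    with d , k'+d≡k ← m≤n⇒∃[o]m+o≡n k'≤k =
    long-short-disjoint d u≢v fu≡q fv≡q (≤-trans (m≤n+m d k') (≤-trans (≤-reflexive k'+d≡k) k≤e))
      (⊕-cancel-+ʳ (d * a) d (k' * a + x) (begin
        u ⊕ (d * a + (k' * a + x)) ≡⟨ cong (u ⊕_) (solve (d ∷ a' ∷ k' ∷ x ∷ [])) ⟩
        u ⊕ ((k' + d) * a + x)     ≡⟨ cong (λ t → u ⊕ (t * a + x)) k'+d≡k ⟩
        u ⊕ (k * a + x)            ≡⟨ eq ⟩
        v ⊕ (k' * a + x')          ≡⟨ cong (λ t → v ⊕ (k' * a + t)) x'≡x+d ⟩
        v ⊕ (k' * a + (x + d))     ≡⟨ cong (v ⊕_) (solve (k' ∷ a' ∷ x ∷ d ∷ [])) ⟩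
        v ⊕ (d + (k' * a + x))     ∎))
    where
    open ≡-Reasoning
    x'≡x+d : x' ≡ x + d
    x'≡x+d = +-cancelʳ-≡ k' x' (x + d) (begin
      x' + k'      ≡⟨ x'+k'≡q ⟩
      q            ≡⟨ x+k≡q ⟨
      x + k        ≡⟨ cong (x +_) k'+d≡k ⟨
      x + (k' + d) ≡⟨ solve (x ∷ k' ∷ d ∷ []) ⟩
      x + d + k'   ∎)

  extra-extra-disjoint : ∀ {u v k k' x x'} → u ≢ v → f u ≡ q → f v ≡ q → x + k ≡ q → x' + k' ≡ q →
                         k ≤ e → k' ≤ e → u ⊕ (k * a + x) ≢ v ⊕ (k' * a + x')
  extra-extra-disjoint {k = k} {k'} u≢v fu≡q fv≡q x+k≡q x'+k'≡q k≤e k'≤e with ≤-total k' k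
  ... | inj₁ k'≤k = extra-extra-disjoint-≤ u≢v fu≡q fv≡q x+k≡q x'+k'≡q k≤e k'≤k
  ... | inj₂ k≤k' = extra-extra-disjoint-≤ (u≢v ∘ sym) fv≡q fu≡q x'+k'≡q x+k≡q k'≤e k≤k' ∘ sym

  path : Fin n → List (Fin n)
  path v = applyUpTo (v ⊕_) (pathSize (f v))

  -- v ⊕ (q + k a') = v ⊕ (k a + (q − k)): the end of a walk of length q using k long chords.
  extras : Fin n → List (Fin n)
  extras v with f v ≟ q
  ... | yes _ = applyUpTo (λ i → v ⊕ (q + suc i * a')) e
  ... | no  _ = []

  footprint : Fin n → List (Fin n)
  footprint v = path v ++ extras v

  ∈-path⁻ : ∀ {p v} → p ∈ path v → 0 < f v × ∃ λ j → j ≤ f v × p ≡ v ⊕ j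
  ∈-path⁻ {v = v} p∈ with j , j<size , p≡v⊕j ← ∈-applyUpTo⁻ (v ⊕_) p∈ =
    let 0<fv , j≤fv = <pathSize⇒ j<size in 0<fv , j , j≤fv , p≡v⊕j

  ∈-extras⁻ : ∀ {p v} → p ∈ extras v → f v ≡ q × ∃ λ i → i < e × p ≡ v ⊕ (q + suc i * a')
  ∈-extras⁻ {v = v} p∈ with f v ≟ q
  ∈-extras⁻ {v = v} p∈ | yes fv≡q = fv≡q , ∈-applyUpTo⁻ _ p∈
  ∈-extras⁻ {v = v} () | no _

  extraOffset-split : ∀ {i} → i < e → ∃ λ x → x + suc i ≡ q × q + suc i * a' ≡ suc i * a + x
  extraOffset-split {i} i<e with x , 1+i+x≡q ← m≤n⇒∃[o]m+o≡n (≤-trans i<e e≤q) =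
    x , trans (+-comm x (suc i)) 1+i+x≡q , (begin
      q + suc i * a'         ≡⟨ cong (_+ suc i * a') 1+i+x≡q ⟨
      suc i + x + suc i * a' ≡⟨ solve (i ∷ x ∷ a' ∷ []) ⟩
      suc i * suc a' + x     ∎)
    where open ≡-Reasoning

  ∈-extras⇒walk : ∀ {p v} → p ∈ extras v → f v ≡ q × ∃₂ λ x k → x + k ≡ q × k ≤ e × p ≡ v ⊕ (k * a + x)
  ∈-extras⇒walk {v = v} p∈ with fv≡q , i , i<e , p≡ ← ∈-extras⁻ p∈ with x , x+1+i≡q , offset≡ ← extraOffset-split i<e =
    fv≡q , x , suc i , x+1+i≡q , i<e , trans p≡ (cong (v ⊕_) offset≡)

  footprints-disjoint : ∀ {u v} → u ≢ v → Disjoint (footprint u) (footprint v)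
  footprints-disjoint {u} {v} u≢v (p∈u , p∈v) with ∈-++⁻ (path u) p∈u | ∈-++⁻ (path v) p∈v
  ... | inj₁ p∈pu | inj₁ p∈pv
    with 0<fu , j , j≤fu , p≡u⊕j ← ∈-path⁻ p∈pu | 0<fv , j' , j'≤fv , p≡v⊕j' ← ∈-path⁻ p∈pv =
    path-path-disjoint u≢v 0<fu 0<fv j≤fu j'≤fv (trans (sym p≡u⊕j) p≡v⊕j')
  ... | inj₁ p∈pu | inj₂ p∈ev
    with 0<fu , j , j≤fu , p≡u⊕j ← ∈-path⁻ p∈pu | fv≡q , x , k , x+k≡q , k≤e , p≡v⊕ ← ∈-extras⇒walk p∈ev =
    path-extra-disjoint u≢v 0<fu fv≡q j≤fu x+k≡q k≤e (trans (sym p≡u⊕j) p≡v⊕)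
  ... | inj₂ p∈eu | inj₁ p∈pv
    with fu≡q , x , k , x+k≡q , k≤e , p≡u⊕ ← ∈-extras⇒walk p∈eu | 0<fv , j , j≤fv , p≡v⊕j ← ∈-path⁻ p∈pv =
    path-extra-disjoint (u≢v ∘ sym) 0<fv fu≡q j≤fv x+k≡q k≤e (trans (sym p≡v⊕j) p≡u⊕)
  ... | inj₂ p∈eu | inj₂ p∈ev
    with fu≡q , x , k , x+k≡q , k≤e , p≡u⊕ ← ∈-extras⇒walk p∈eu
       | fv≡q , x' , k' , x'+k'≡q , k'≤e , p≡v⊕ ← ∈-extras⇒walk p∈ev =
    extra-extra-disjoint u≢v fu≡q fv≡q x+k≡q x'+k'≡q k≤e k'≤e (trans (sym p≡u⊕) p≡v⊕)

  path-unique : ∀ v → Unique (path v)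
  path-unique v = applyUpTo⁺₁ (v ⊕_) (pathSize (f v)) λ i<j j<size →
    ⊕-injective-< v i<j (≤-<-trans (≤-trans (proj₂ (<pathSize⇒ j<size)) (qb v)) q<n)

  extras-unique : ∀ v → Unique (extras v)
  extras-unique v with f v ≟ q
  ... | yes _ = applyUpTo⁺₁ _ e λ i<j j<e →
    ⊕-injective-< v (+-monoʳ-< q (*-monoˡ-< a' (s≤s i<j))) (extraOffset-< j<e)
  ... | no  _ = []

  path-extras-disjoint : ∀ v → Disjoint (path v) (extras v)
  path-extras-disjoint v (p∈path , p∈extras)
    with _ , j , j≤fv , p≡v⊕j ← ∈-path⁻ p∈path | _ , i , i<e , p≡v⊕offset ← ∈-extras⁻ p∈extras =
    ⊕-injective-< v j<offset (extraOffset-< i<e) (trans (sym p≡v⊕j) p≡v⊕offset)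
    where
    j<offset : j < q + suc i * a'
    j<offset = ≤-<-trans (≤-trans j≤fv (qb v)) (m<m+n q (*-monoˡ-< a' {0} {suc i} (s≤s z≤n)))

  footprint-unique : ∀ v → Unique (footprint v)
  footprint-unique v = ++⁺ (path-unique v) (extras-unique v) (path-extras-disjoint v)

  footprints-unique : Unique (concatMap footprint (allFin n))
  footprints-unique = concat⁺ (All.map⁺ (All.universal footprint-unique (allFin n)))
    (AllPairs.map⁺ (AllPairs.map footprints-disjoint (allFin⁺ n)))

  sum-footprint-sizes≤n : sum (map (length ∘ footprint) (allFin n)) ≤ n
  sum-footprint-sizes≤n = subst (_≤ n) (length-concatMap footprint (allFin n)) (Unique⇒length≤ footprints-unique)

  length-extras-yes : ∀ {v} → f v ≡ q → length (extras v) ≡ e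
  length-extras-yes {v} fv≡q with f v ≟ q
  ... | yes _ = length-applyUpTo _ e
  ... | no fv≢q = contradiction fv≡q fv≢q

  length-extras-no : ∀ {v} → f v ≢ q → length (extras v) ≡ 0
  length-extras-no {v} fv≢q with f v ≟ q
  ... | yes fv≡q = contradiction fv≡q fv≢q
  ... | no _ = refl

  length-footprint : ∀ v → length (footprint v) ≡ pathSize (f v) + length (extras v)
  length-footprint v = trans (length-++ (path v)) (cong (_+ length (extras v)) (length-applyUpTo (v ⊕_) (pathSize (f v))))

  cost-bound : ∀ c → q * q + c ≤ (q ∸ 1) * (pathSize q + e) → q * cost n f + c * countEq n q f ≤ (q ∸ 1) * n
  cost-bound c qq+c≤ = ≤-trans
    (sum-weighted-≤ (λ v → f v ≟ q) f (length ∘ footprint) {q} {c} {q ∸ 1} weight-q weight-<q (allFin n))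
    (*-monoʳ-≤ (q ∸ 1) sum-footprint-sizes≤n)
    where
    weight-q : ∀ v → f v ≡ q → q * f v + c ≤ (q ∸ 1) * length (footprint v)
    weight-q v fv≡q = subst₂ _≤_ (cong (λ t → q * t + c) (sym fv≡q))
      (cong ((q ∸ 1) *_) (sym (trans (length-footprint v) (cong₂ _+_ (cong pathSize fv≡q) (length-extras-yes fv≡q)))))
      qq+c≤
    weight-<q : ∀ v → f v ≢ q → q * f v ≤ (q ∸ 1) * length (footprint v)
    weight-<q v fv≢q = subst (q * f v ≤_)
      (cong ((q ∸ 1) *_) (sym (trans (length-footprint v) (trans (cong (pathSize (f v) +_) (length-extras-no fv≢q)) (+-identityʳ _)))))
      (*-pathSize-≤ (≤∧≢⇒< (qb v) fv≢q))

cost-bound-n≡qa : ∀ {n a' p} .{{_ : NonZero n}} → n ≡ suc (suc p) * suc a' → 0 < a' →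
  (f : Fin n → ℕ) → IndependentBroadcast n (suc a') f → QBounded n (suc (suc p)) f →
  cost n f + p * countEq n (suc (suc p)) f ≤ suc p * n / suc (suc p)
cost-bound-n≡qa {n} {a'} {p} n≡qa 0<a' f ib qb = m*n≤o⇒n≤o/m q (begin
  q * (cost n f + p * k)     ≡⟨ rearrange (cost n f) k ⟩
  q * cost n f + q * p * k   ≤⟨ Footprints.cost-bound n a' q (suc p) 0 (sym (+-identityʳ q)) z≤n
                                  (trans (sym n≡qa) (sym (+-identityʳ n))) (s≤s z≤n) 0<a' f ib qb
                                  (q * p) (≤-reflexive weight-of-q) ⟩
  suc p * n                  ∎)
  where
  open ≤-Reasoning
  q = suc (suc p)
  k = countEq n q f
  rearrange : ∀ σ m → suc (suc p) * (σ + p * m) ≡ suc (suc p) * σ + suc (suc p) * p * m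
  rearrange σ m = solve (σ ∷ m ∷ p ∷ [])
  weight-of-q : suc (suc p) * suc (suc p) + suc (suc p) * p ≡ suc p * (suc (suc (suc p)) + suc p)
  weight-of-q = solve (p ∷ [])

cost-bound-n≡qa+a-1 : ∀ {n a' p} .{{_ : NonZero n}} → n ≡ suc (suc p) * suc a' + a' → 0 < a' →
  (f : Fin n → ℕ) → IndependentBroadcast n (suc a') f → QBounded n (suc (suc p)) f →
  cost n f + p * countEq n (suc (suc p)) f ≤ suc p * (n ∸ countEq n (suc (suc p)) f) / suc (suc p)
cost-bound-n≡qa+a-1 {n} {a'} {p} n≡qa+a' 0<a' f ib qb = m*n≤o⇒n≤o/m q (begin
  q * (cost n f + p * k)    ≤⟨ m+n≤o⇒m≤o∸n _ (begin
    q * (cost n f + p * k) + suc p * k ≡⟨ rearrange (cost n f) k ⟩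
    q * cost n f + (q * p + suc p) * k ≤⟨ Footprints.cost-bound n a' q q 1 (+-comm 1 q) ≤-refl
                                            [q+1]a≡n+1 (s≤s z≤n) 0<a' f ib qb
                                            (q * p + suc p) (≤-reflexive weight-of-q) ⟩
    suc p * n                          ∎) ⟩
  suc p * n ∸ suc p * k     ≡⟨ *-distribˡ-∸ (suc p) n k ⟨
  suc p * (n ∸ k)           ∎)
  where
  open ≤-Reasoning
  q = suc (suc p)
  k = countEq n q f
  rearrange : ∀ σ m → suc (suc p) * (σ + p * m) + suc p * m ≡ suc (suc p) * σ + (suc (suc p) * p + suc p) * m
  rearrange σ m = solve (σ ∷ m ∷ p ∷ [])
  weight-of-q : suc (suc p) * suc (suc p) + (suc (suc p) * p + suc p) ≡ suc p * (suc (suc (suc p)) + suc (suc p))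
  weight-of-q = solve (p ∷ [])
  [q+1]a≡qa+a'+1 : suc (suc (suc p)) * suc a' ≡ suc (suc p) * suc a' + a' + 1
  [q+1]a≡qa+a'+1 = solve (p ∷ a' ∷ [])
  [q+1]a≡n+1 : suc q * suc a' ≡ n + 1
  [q+1]a≡n+1 = trans [q+1]a≡qa+a'+1 (cong (_+ 1) (sym n≡qa+a'))

proposition22 : (n a q r : ℕ) → n ≡ q * a + r → (r ≡ 0 ⊎ r ≡ a ∸ 1) → 4 ≤ a → 2 ≤ q → q < a ∸ 1 →
    (f : Fin n → ℕ) → IndependentBroadcast n a f → QBounded n q f →
    (r ≡ 0 → cost n f + (q ∸ 2) * countEq n q f ≤ floorDiv ((q ∸ 1) * n) q)
    × (r ≡ a ∸ 1 → cost n f + (q ∸ 2) * countEq n q f ≤ floorDiv ((q ∸ 1) * (n ∸ countEq n q f)) q)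
proposition22 _ (suc a') (suc (suc p)) r refl _ (s≤s 3≤a') (s≤s (s≤s z≤n)) _ f ib qb =
    (λ r≡0 → cost-bound-n≡qa (trans (cong (qa +_) r≡0) (+-identityʳ qa)) 0<a' f ib qb)
  , (λ r≡a' → cost-bound-n≡qa+a-1 (cong (qa +_) r≡a') 0<a' f ib qb)
  where
  qa = suc (suc p) * suc a'
  0<a' : 0 < a'
  0<a' = ≤-trans (s≤s z≤n) 3≤a'
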